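{- Let $D$ be a valid connected diagram in right normal form and $v$ a vertex of $D$. Fix a side of $v$ (inputs or outputs) and a position $j\in\{0,\dots,k\}$ among the $k$ existing edges on that side of $v$. Consider the valid diagrams $D'$ obtained from $D$ by adding one new vertex $l$ incident to exactly one edge, this edge joining $l$ to $v$ and occupying position $j$ on the chosen side of $v$ (so that $l$ has no inputs and one output if the chosen side is the inputs of $v$, and one input and no outputs otherwise), and such that deleting $l$ and its edge from $D'$ gives back $D$. Then there is a unique vertical position of $l$, i.e. exactly one such $D'$, which is in right normal form.
   Context: A diagram is a tuple $D=(S,N,H,I,O)$ with $S,N\in\mathbb N$ and $H,I,O:\{0,\dots,N-1\}\to\mathbb N$; $\Delta(n)=O(n)-I(n)$, $W(0)=S$, $W(n+1)=W(n)+\Delta(n)$; $D$ is valid if $W(n)\ge H(n)+I(n)$ for all $n<N$. Geometrically, the vertex at height $n$ (heights numbered top to bottom) has as inputs (left to right) the wires $H(n),\dots,H(n)+I(n)-1$ among the $W(n)$ wires crossing level $n$ (numbered left to right) and as outputs the wires $H(n),\dots,H(n)+O(n)-1$ of level $n+1$; wire $k<H(n)$ of level $n$ continues as wire $k$ of level $n+1$ and wire $k\ge H(n)+I(n)$ continues as wire $k+\Delta(n)$. Edges are the resulting maximal wire chains. $D$ is connected if the multigraph whose vertices are the vertices of $D$ and whose edges are the edges joining two vertices is connected. For $0\le n\le N-2$, a right exchange at height $n$ is admissible when $H(n+1)\ge H(n)+O(n)$. A diagram is in right normal form if it is valid and admits no right exchange. -}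

module Defs where

open import Data.Nat using (ℕ; zero; suc; _+_; _∸_; _≤_; _<_; _<?_; _<ᵇ_)
open import Data.Nat.Properties using ()
open import Data.Bool using (Bool; true; false; if_then_else_)
open import Data.Fin using (Fin; toℕ)
open import Data.List using (List; []; _∷_; length; lookup; take; drop; reverse; _++_)
open import Data.Maybe using (Maybe; just; nothing)
import Data.Maybe as Maybe
open import Data.Product using (Σ; _×_; _,_; ∃; map₁)
open import Data.Unit using (⊤)
open import Relation.Nullary using (¬_; yes; no)
open import Relation.Binary.PropositionalEquality using (_≡_)
open import Relation.Binary.Construct.Closure.ReflexiveTransitive using (Star)
open import Relation.Binary.Construct.Closure.Symmetric using (SymClosure)

-- A diagram (S,N,H,I,O) is represented by S together with the
-- list of the N vertex triples (H(n), I(n), O(n)), listed by height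
-- n = 0 … N-1 (top to bottom).

record Vtx : Set where
  constructor vtx
  field
    H I O : ℕ
open Vtx public

record Diagram : Set where
  constructor diagram
  field
    S  : ℕ
    vs : List Vtx
open Diagram public

N : Diagram → ℕ
N D = length (vs D)

V : (D : Diagram) → Fin (N D) → Vtx
V D n = lookup (vs D) n

wAfter : ℕ → List Vtx → ℕ
wAfter w []       = w
wAfter w (x ∷ xs) = wAfter ((w + O x) ∸ I x) xs

W : Diagram → ℕ → ℕ
W D n = wAfter (S D) (take n (vs D))

Valid : Diagram → Set
Valid D = (n : Fin (N D)) → H (V D n) + I (V D n) ≤ W D (toℕ n)

RightExchangeAdmissible : (D : Diagram) → (n n' : Fin (N D)) → Set
RightExchangeAdmissible D n n' =
  toℕ n' ≡ suc (toℕ n) × H (V D n) + O (V D n) ≤ H (V D n')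

RightNormalForm : Diagram → Set
RightNormalForm D =
  Valid D × ((n n' : Fin (N D)) → ¬ RightExchangeAdmissible D n n')

-- Following a wire.
-- traceDown xs k : follow wire k of the level just above the vertices xs
-- (xs listed top to bottom) downward.  Returns just (i , q) if it is the
-- input q of the i-th vertex of xs, nothing if it reaches the bottom.

traceDown : List Vtx → ℕ → Maybe (ℕ × ℕ)
traceDown []       k = nothing
traceDown (x ∷ xs) k with k <? H x
... | yes _ = Maybe.map (map₁ suc) (traceDown xs k)
... | no _ with k <? H x + I x
...   | yes _ = just (0 , k ∸ H x)
...   | no _  = Maybe.map (map₁ suc) (traceDown xs ((k + O x) ∸ I x))

-- traceUp xs k : xs listed bottom to top (nearest first), follow wire k of
-- the level just below the first vertex of xs upward.  Returns just (i , q)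
-- if it is the output q of the i-th vertex of xs, nothing if it reaches
-- the top.
traceUp : List Vtx → ℕ → Maybe (ℕ × ℕ)
traceUp []       k = nothing
traceUp (x ∷ xs) k with k <? H x
... | yes _ = Maybe.map (map₁ suc) (traceUp xs k)
... | no _ with k <? H x + O x
...   | yes _ = just (0 , k ∸ H x)
...   | no _  = Maybe.map (map₁ suc) (traceUp xs ((k + I x) ∸ O x))

Adj : (D : Diagram) → Fin (N D) → Fin (N D) → Set
Adj D a b =
  Σ ℕ λ p → p < O (V D a) ×
  Σ ℕ λ i → Σ ℕ λ q →
    traceDown (drop (suc (toℕ a)) (vs D)) (H (V D a) + p) ≡ just (i , q)
    × toℕ b ≡ suc (toℕ a + i)

Connected : Diagram → Set
Connected D = (a b : Fin (N D)) → Star (SymClosure (Adj D)) a b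

-- Deleting the edge of a leaf.
-- deleteDown xs k : remove the wire k (level above xs) going down through
-- the vertices xs, adjusting H / I of the vertices it passes / enters.
deleteDown : List Vtx → ℕ → List Vtx
deleteDown []       k = []
deleteDown (x ∷ xs) k with k <? H x
... | yes _ = vtx (H x ∸ 1) (I x) (O x) ∷ deleteDown xs k
... | no _ with k <? H x + I x
...   | yes _ = vtx (H x) (I x ∸ 1) (O x) ∷ xs
...   | no _  = x ∷ deleteDown xs ((k + O x) ∸ I x)

-- deleteUp xs k : xs listed bottom to top; remove wire k going upward.
-- The Bool says whether the wire reached the top boundary.
deleteUp : List Vtx → ℕ → List Vtx × Bool
deleteUp []       k = [] , true
deleteUp (x ∷ xs) k with k <? H x
... | yes _ with deleteUp xs k
...   | r , t = vtx (H x ∸ 1) (I x) (O x) ∷ r , t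
deleteUp (x ∷ xs) k | no _ with k <? H x + O x
...   | yes _ = vtx (H x) (I x) (O x ∸ 1) ∷ xs , false
...   | no _ with deleteUp xs ((k + I x) ∸ O x)
...     | r , t = x ∷ r , t

data Side : Set where
  inputs outputs : Side

arity : Side → Vtx → ℕ
arity inputs  x = I x
arity outputs x = O x

-- delete the vertex at height m (a leaf whose only edge is an output edge
-- if s = inputs, an input edge if s = outputs) together with its edge
deleteLeaf : Side → (D : Diagram) → Fin (N D) → Diagram
deleteLeaf inputs D m =
  diagram (S D)
    (take (toℕ m) (vs D) ++ deleteDown (drop (suc (toℕ m)) (vs D)) (H (V D m)))
deleteLeaf outputs D m with deleteUp (reverse (take (toℕ m) (vs D))) (H (V D m))
... | r , t = diagram (if t then S D ∸ 1 else S D)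
                      (reverse r ++ drop (suc (toℕ m)) (vs D))

-- index in D' of the vertex with index v in D, after inserting at height m
punchInℕ : ℕ → ℕ → ℕ
punchInℕ m v = if v <ᵇ m then v else suc v

LeafIncidence : Side → (D' : Diagram) → Fin (N D') → ℕ → ℕ → Set
LeafIncidence inputs D' m t j =
  I (V D' m) ≡ 0 × O (V D' m) ≡ 1 ×
  Σ ℕ λ i → traceDown (drop (suc (toℕ m)) (vs D')) (H (V D' m)) ≡ just (i , j)
          × t ≡ suc (toℕ m + i)
LeafIncidence outputs D' m t j =
  I (V D' m) ≡ 1 × O (V D' m) ≡ 0 ×
  Σ ℕ λ i → traceUp (reverse (take (toℕ m) (vs D'))) (H (V D' m)) ≡ just (i , j)
          × toℕ m ≡ suc (i + t)

LeafExtension : (D : Diagram) → Fin (N D) → Side → ℕ → Diagram → Set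
LeafExtension D v s j D' =
  Valid D' ×
  Σ (Fin (N D')) λ m →
    LeafIncidence s D' m (punchInℕ (toℕ m) (toℕ v)) j
    × deleteLeaf s D' m ≡ D

module Submission where

-- Validity
-- and the absence of admissible right exchanges become local conditions on
-- this list: 'ValidFrom' (every vertex fits in the current width) and 'Rigid'
-- (no vertex can be right-exchanged with the vertex directly below it).
--
-- A leaf feeding input j of v emits the wire H(v)+j that enters v.
-- Following this wire upwards from v, the leaf must lie above every vertex the
-- wire passes on the right (otherwise that vertex and the leaf are
-- exchangeable) and below the first vertex the wire does not pass on the right
-- (otherwise the leaf and that vertex are exchangeable).  'ascend' computes
-- this position and 'ascent-unique' shows that it is forced.  Dually, a leaf absorbing output j of v lies below v, after the
-- maximal run of following vertices lying strictly right of its wire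
-- ('descend', 'descent-unique').
-- For both sides, the leaf placed at the computed position gives a valid rigid
-- diagram (existence), and any right-normal leaf extension is traced back,
-- using rigidity of D, to the same diagram (uniqueness).

open import Defs
open import Data.Nat using (ℕ; zero; suc; _+_; _∸_; _≤_; _<_; _<?_; _≤?_; _<ᵇ_; z≤n; s≤s)
open import Data.Nat.Properties
open import Data.Bool using (true; false; T; if_then_else_)
open import Data.Fin using (Fin; toℕ) renaming (zero to fzero; suc to fsuc)
open import Data.List using (List; []; _∷_; length; lookup; take; drop; reverse; _++_; map)
open import Data.List.Properties using (++-assoc; unfold-reverse; reverse-++; reverse-involutive; length-reverse; reverse-map; length-++)
open import Data.List.Relation.Unary.All using (All; []; _∷_)
open import Data.List.Relation.Unary.All.Properties using (++⁺)
open import Data.Maybe using (Maybe; just; nothing)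
import Data.Maybe as Maybe
open import Data.Product using (Σ; _×_; _,_; map₁; proj₁; proj₂)
open import Data.Unit using (⊤; tt)
open import Data.Empty using (⊥-elim)
open import Relation.Nullary using (¬_; yes; no)
open import Relation.Binary.PropositionalEquality

ValidFrom : ℕ → List Vtx → Set
ValidFrom w []       = ⊤
ValidFrom w (x ∷ xs) = H x + I x ≤ w × ValidFrom ((w + O x) ∸ I x) xs

Valid⇒ValidFrom : ∀ S xs → Valid (diagram S xs) → ValidFrom S xs
Valid⇒ValidFrom S []       valid = tt
Valid⇒ValidFrom S (x ∷ xs) valid = valid fzero , Valid⇒ValidFrom _ xs (λ n → valid (fsuc n))

ValidFrom⇒Valid : ∀ S xs → ValidFrom S xs → Valid (diagram S xs)
ValidFrom⇒Valid S (x ∷ xs) (fits , rest) fzero    = fits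
ValidFrom⇒Valid S (x ∷ xs) (fits , rest) (fsuc n) = ValidFrom⇒Valid _ xs rest n

Exchangeable : Vtx → Vtx → Set
Exchangeable x y = H x + O x ≤ H y

StuckOn : Vtx → List Vtx → Set
StuckOn x []      = ⊤
StuckOn x (y ∷ _) = ¬ Exchangeable x y

Rigid : List Vtx → Set
Rigid []       = ⊤
Rigid (x ∷ xs) = StuckOn x xs × Rigid xs

NoRightExchange : Diagram → Set
NoRightExchange D = (n n' : Fin (N D)) → ¬ RightExchangeAdmissible D n n'

NoRightExchange⇒Rigid : ∀ S xs → NoRightExchange (diagram S xs) → Rigid xs
NoRightExchange⇒Rigid S []           noEx = tt
NoRightExchange⇒Rigid S (x ∷ [])     noEx = tt , tt
NoRightExchange⇒Rigid S (x ∷ y ∷ xs) noEx =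
  (λ exch → noEx fzero (fsuc fzero) (refl , exch)) ,
  NoRightExchange⇒Rigid S (y ∷ xs) (λ n n' (adj , exch) → noEx (fsuc n) (fsuc n') (cong suc adj , exch))

Rigid⇒NoRightExchange : ∀ S xs → Rigid xs → NoRightExchange (diagram S xs)
Rigid⇒NoRightExchange S (x ∷ xs)     rigid          fzero    fzero             (() , _)
Rigid⇒NoRightExchange S (x ∷ y ∷ xs) (stuck , _)    fzero    (fsuc fzero)      (_ , exch) = stuck exch
Rigid⇒NoRightExchange S (x ∷ y ∷ xs) rigid          fzero    (fsuc (fsuc n'))  (() , _)
Rigid⇒NoRightExchange S (x ∷ xs)     rigid          (fsuc n) fzero             (() , _)
Rigid⇒NoRightExchange S (x ∷ xs)     (_ , rigid)    (fsuc n) (fsuc n')         (adj , exch) =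
  Rigid⇒NoRightExchange S xs rigid n n' (suc-injective adj , exch)

split-at : (L : List Vtx) (m : Fin (length L)) → L ≡ take (toℕ m) L ++ lookup L m ∷ drop (suc (toℕ m)) L
split-at (x ∷ L) fzero    = refl
split-at (x ∷ L) (fsuc m) = cong (x ∷_) (split-at L m)

length-take : (L : List Vtx) (m : Fin (length L)) → length (take (toℕ m) L) ≡ toℕ m
length-take (x ∷ L) fzero    = refl
length-take (x ∷ L) (fsuc m) = cong suc (length-take L m)

head-or : Vtx → List Vtx → Vtx
head-or d []      = d
head-or d (y ∷ _) = y

++-∷-cancel : ∀ (A A' : List Vtx) {y y' B B'} → A ++ y ∷ B ≡ A' ++ y' ∷ B' → length A ≡ length A' →
  A ≡ A' × y ≡ y' × B ≡ B'
++-∷-cancel []      []        refl  _   = refl , refl , refl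
++-∷-cancel (x ∷ A) (x' ∷ A') eq    len with ++-∷-cancel A A' (cong (drop 1) eq) (suc-injective len)
... | eqA , eqy , eqB = cong₂ _∷_ (cong (head-or x) eq) eqA , eqy , eqB

reverse-++-∷ : ∀ A (y : Vtx) B → reverse (A ++ y ∷ B) ≡ reverse B ++ y ∷ reverse A
reverse-++-∷ A y B = begin
  reverse (A ++ y ∷ B)           ≡⟨ reverse-++ A (y ∷ B) ⟩
  reverse (y ∷ B) ++ reverse A   ≡⟨ cong (_++ reverse A) (unfold-reverse y B) ⟩
  (reverse B ++ y ∷ []) ++ reverse A ≡⟨ ++-assoc (reverse B) (y ∷ []) (reverse A) ⟩
  reverse B ++ y ∷ reverse A     ∎
  where open ≡-Reasoning

reverse-∷-++ : ∀ (y : Vtx) A B → reverse (y ∷ A) ++ B ≡ reverse A ++ y ∷ B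
reverse-∷-++ y A B = trans (cong (_++ B) (unfold-reverse y A)) (++-assoc (reverse A) (y ∷ []) B)

reverse-map-reverse : ∀ (f : Vtx → Vtx) F → reverse (map f (reverse F)) ≡ map f F
reverse-map-reverse f F = trans (sym (reverse-map f (reverse F))) (cong (map f) (reverse-involutive F))

All-reverse : ∀ {P : Vtx → Set} {xs} → All P xs → All P (reverse xs)
All-reverse {xs = []}     []       = []
All-reverse {xs = x ∷ xs} (p ∷ ps) = subst (All _) (sym (unfold-reverse x xs)) (++⁺ (All-reverse ps) (p ∷ []))

Rigid-suffix : ∀ A {B} → Rigid (A ++ B) → Rigid B
Rigid-suffix []      rigid = rigid
Rigid-suffix (x ∷ A) rigid = Rigid-suffix A (proj₂ rigid)

Rigid-prefix : ∀ A {B} → Rigid (A ++ B) → Rigid A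
Rigid-prefix []          rigid = tt
Rigid-prefix (x ∷ [])    rigid = tt , tt
Rigid-prefix (x ∷ y ∷ A) rigid = proj₁ rigid , Rigid-prefix (y ∷ A) (proj₂ rigid)

LastStuck : List Vtx → ℕ → Set
LastStuck []          k = ⊤
LastStuck (x ∷ [])    k = ¬ (H x + O x ≤ k)
LastStuck (x ∷ y ∷ P) k = LastStuck (y ∷ P) k

LastStuck-tail : ∀ x P {k} → LastStuck (x ∷ P) k → LastStuck P k
LastStuck-tail x []      stuck = tt
LastStuck-tail x (y ∷ P) stuck = stuck

Rigid-last : ∀ A {y B} → Rigid (A ++ y ∷ B) → LastStuck A (H y)
Rigid-last []          rigid = tt
Rigid-last (x ∷ [])    rigid = proj₁ rigid
Rigid-last (x ∷ z ∷ A) rigid = Rigid-last (z ∷ A) (proj₂ rigid)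

Rigid-join : ∀ A {y B} → Rigid A → LastStuck A (H y) → Rigid (y ∷ B) → Rigid (A ++ y ∷ B)
Rigid-join []          _      _     rigid = rigid
Rigid-join (x ∷ [])    _      stuck rigid = stuck , rigid
Rigid-join (x ∷ z ∷ A) rigidA stuck rigid = proj₁ rigidA , Rigid-join (z ∷ A) (proj₂ rigidA) stuck rigid

-- Rigidity only involves the positions and output counts of the vertices.
Rigid-replace : ∀ F {x y C} → H x ≡ H y → O x ≡ O y → Rigid (F ++ x ∷ C) → Rigid (F ++ y ∷ C)
Rigid-replace []          {C = []}    eqH eqO rigid = tt , tt
Rigid-replace []          {C = z ∷ C} eqH eqO rigid =
  (λ exch → proj₁ rigid (subst₂ (λ h o → h + o ≤ H z) (sym eqH) (sym eqO) exch)) , proj₂ rigid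
Rigid-replace (z ∷ [])    eqH eqO rigid =
  (λ exch → proj₁ rigid (subst (H z + O z ≤_) (sym eqH) exch)) , Rigid-replace [] eqH eqO (proj₂ rigid)
Rigid-replace (z ∷ w ∷ F) eqH eqO rigid = proj₁ rigid , Rigid-replace (w ∷ F) eqH eqO (proj₂ rigid)

FirstStuck : ℕ → List Vtx → Set
FirstStuck k []      = ⊤
FirstStuck k (z ∷ _) = ¬ (H z + O z ≤ k)

LastStuck⇒FirstStuck-reverseAcc : ∀ P k acc → LastStuck P k → (P ≡ [] → FirstStuck k acc) →
  FirstStuck k (Data.List.reverseAcc acc P)
LastStuck⇒FirstStuck-reverseAcc []          k acc stuck empty = empty refl
LastStuck⇒FirstStuck-reverseAcc (x ∷ [])    k acc stuck empty = stuck
LastStuck⇒FirstStuck-reverseAcc (x ∷ y ∷ P) k acc stuck empty =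
  LastStuck⇒FirstStuck-reverseAcc (y ∷ P) k (x ∷ acc) stuck (λ ())

LastStuck⇒FirstStuck-reverse : ∀ P k → LastStuck P k → FirstStuck k (reverse P)
LastStuck⇒FirstStuck-reverse P k stuck = LastStuck⇒FirstStuck-reverseAcc P k [] stuck (λ _ → tt)

ValidFrom-prefix : ∀ w A {B} → ValidFrom w (A ++ B) → ValidFrom w A
ValidFrom-prefix w []      valid = tt
ValidFrom-prefix w (x ∷ A) valid = proj₁ valid , ValidFrom-prefix _ A (proj₂ valid)

ValidFrom-suffix : ∀ w A {B} → ValidFrom w (A ++ B) → ValidFrom (wAfter w A) B
ValidFrom-suffix w []      valid = valid
ValidFrom-suffix w (x ∷ A) valid = ValidFrom-suffix _ A (proj₂ valid)

ValidFrom-join : ∀ w A {B} → ValidFrom w A → ValidFrom (wAfter w A) B → ValidFrom w (A ++ B)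
ValidFrom-join w []      validA validB = validB
ValidFrom-join w (x ∷ A) validA validB = proj₁ validA , ValidFrom-join _ A (proj₂ validA) validB

width-suc : ∀ {I w} O → I ≤ w → (suc w + O) ∸ I ≡ suc ((w + O) ∸ I)
width-suc {I} {w} O I≤w = +-∸-assoc 1 (≤-trans I≤w (m≤m+n w O))

right-of-inputs⇒right-of-outputs : ∀ {h i o k} → h + i ≤ k → h + o ≤ (k + o) ∸ i
right-of-inputs⇒right-of-outputs {h} {i} {o} {k} right = m+n≤o⇒m≤o∸n (h + o) (begin
  h + o + i   ≡⟨ +-assoc h o i ⟩
  h + (o + i) ≡⟨ cong (h +_) (+-comm o i) ⟩
  h + (i + o) ≡⟨ sym (+-assoc h i o) ⟩
  h + i + o   ≤⟨ +-monoˡ-≤ o right ⟩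
  k + o       ∎)
  where open ≤-Reasoning

width-reflects-≤ : ∀ {i k w} o → i ≤ k → i ≤ w → (k + o) ∸ i ≤ (w + o) ∸ i → k ≤ w
width-reflects-≤ {i} {k} {w} o i≤k i≤w le = +-cancelʳ-≤ o k w (begin
  k + o           ≡⟨ sym (m∸n+n≡m (≤-trans i≤k (m≤m+n k o))) ⟩
  (k + o) ∸ i + i ≤⟨ +-monoˡ-≤ i le ⟩
  (w + o) ∸ i + i ≡⟨ m∸n+n≡m (≤-trans i≤w (m≤m+n w o)) ⟩
  w + o           ∎)
  where open ≤-Reasoning

width-injective : ∀ {i k k'} o → i ≤ k → i ≤ k' → (k + o) ∸ i ≡ (k' + o) ∸ i → k ≡ k'
width-injective o i≤k i≤k' eq =
  ≤-antisym (width-reflects-≤ o i≤k i≤k' (≤-reflexive eq)) (width-reflects-≤ o i≤k' i≤k (≤-reflexive (sym eq)))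

<⇒≤∸1 : ∀ {a b} → a < b → a ≤ b ∸ 1
<⇒≤∸1 {b = suc b} (s≤s a≤b) = a≤b

cong-vtx : ∀ {h i o h' i' o'} → h ≡ h' → i ≡ i' → o ≡ o' → vtx h i o ≡ vtx h' i' o'
cong-vtx refl refl refl = refl

-- Wires travelling downwards (input side).

data PassesRight : ℕ → List Vtx → ℕ → Set where
  done : ∀ {k} → PassesRight k [] k
  step : ∀ {k x F g} → H x + I x ≤ k → PassesRight ((k + O x) ∸ I x) F g → PassesRight k (x ∷ F) g

PassesRight-source : ∀ {k k' F g} → PassesRight k F g → PassesRight k' F g → k ≡ k'
PassesRight-source done done = refl
PassesRight-source {F = x ∷ F} (step right r) (step right' r') =
  width-injective (O x) (m+n≤o⇒n≤o (H x) right) (m+n≤o⇒n≤o (H x) right') (PassesRight-source r r')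

traceDown-PassesRight : ∀ {k F g} x C → PassesRight k F g → H x ≤ g → g < H x + I x →
  traceDown (F ++ x ∷ C) k ≡ just (length F , g ∸ H x) ×
  deleteDown (F ++ x ∷ C) k ≡ F ++ vtx (H x) (I x ∸ 1) (O x) ∷ C
traceDown-PassesRight {k} x C done H≤g g<end with k <? H x
... | yes k<H = ⊥-elim (<⇒≱ k<H H≤g)
... | no _ with k <? H x + I x
...   | yes _       = refl , refl
...   | no k≮end    = ⊥-elim (k≮end g<end)
traceDown-PassesRight {k} {y ∷ F} x C (step right r) H≤g g<end with k <? H y
... | yes k<H = ⊥-elim (<⇒≱ k<H (m+n≤o⇒m≤o (H y) right))
... | no _ with k <? H y + I y
...   | yes k<end = ⊥-elim (<⇒≱ k<end right)
...   | no _ with traceDown-PassesRight x C r H≤g g<end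
...     | trace , delete = cong (Maybe.map (map₁ suc)) trace , cong (y ∷_) delete

deleteDown-enter : ∀ y R k → ¬ k < H y → k < H y + I y → deleteDown (y ∷ R) k ≡ vtx (H y) (I y ∸ 1) (O y) ∷ R
deleteDown-enter y R k k≮H k<end with k <? H y
... | yes k<H = ⊥-elim (k≮H k<H)
... | no _ with k <? H y + I y
...   | yes _    = refl
...   | no k≮end = ⊥-elim (k≮end k<end)

deleteDown-right : ∀ y R k → ¬ k < H y → ¬ k < H y + I y → deleteDown (y ∷ R) k ≡ y ∷ deleteDown R ((k + O y) ∸ I y)
deleteDown-right y R k k≮H k≮end with k <? H y
... | yes k<H = ⊥-elim (k≮H k<H)
... | no _ with k <? H y + I y
...   | yes k<end = ⊥-elim (k≮end k<end)
...   | no _      = refl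

Maybe-map-suc⁻ : ∀ (r : Maybe (ℕ × ℕ)) {i j} → Maybe.map (map₁ suc) r ≡ just (i , j) →
  Σ ℕ λ i' → r ≡ just (i' , j) × i ≡ suc i'
Maybe-map-suc⁻ (just (i' , j)) refl = i' , refl , refl

StartsBy : ℕ → List Vtx → Set
StartsBy k []      = ⊤
StartsBy k (y ∷ _) = H y ≤ k

record DownPath (k i j : ℕ) (R : List Vtx) : Set where
  field
    passed : List Vtx
    vertex : Vtx
    rest   : List Vtx
    exit   : ℕ
    R-split : R ≡ passed ++ vertex ∷ rest
    passes  : PassesRight k passed exit
    enters  : H vertex ≤ exit
    enters' : exit < H vertex + I vertex
    input   : j ≡ exit ∸ H vertex
    steps   : i ≡ length passed
    deleted : deleteDown R k ≡ passed ++ vtx (H vertex) (I vertex ∸ 1) (O vertex) ∷ rest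

stuck⇒StartsBy : ∀ y R k → H y + O y ≤ k → StuckOn y (deleteDown R k) → StartsBy k R
stuck⇒StartsBy y []      k right stuck = tt
stuck⇒StartsBy y (z ∷ R) k right stuck with k <? H z
... | yes k<H = ⊥-elim (stuck (≤-trans right (<⇒≤∸1 k<H)))
... | no k≮H  = ≮⇒≥ k≮H

stuck-leaf⇒StartsBy : ∀ y R → O y ≡ 1 → StuckOn y R → StartsBy (H y) R
stuck-leaf⇒StartsBy y []      O≡1 stuck = tt
stuck-leaf⇒StartsBy y (z ∷ R) O≡1 stuck =
  ≤-pred (≤-trans (≰⇒> (λ exch → stuck (subst (λ o → H y + o ≤ H z) (sym O≡1) exch))) (≤-reflexive (+-comm (H y) 1)))

rigid-downPath : ∀ R k i j → traceDown R k ≡ just (i , j) → StartsBy k R → Rigid (deleteDown R k) →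
  DownPath k i j R
rigid-downPath []      k i j () startsBy rigid
rigid-downPath (y ∷ R) k i j trace startsBy rigid with k <? H y
... | yes k<H = ⊥-elim (<⇒≱ k<H startsBy)
... | no k≮H with k <? H y + I y
...   | yes k<end with trace
...     | refl = record
  { passed = [] ; vertex = y ; rest = R ; exit = k ; R-split = refl ; passes = done ; enters = startsBy ; enters' = k<end
  ; input = refl ; steps = refl ; deleted = deleteDown-enter y R k k≮H k<end }
rigid-downPath (y ∷ R) k i j trace startsBy rigid | no k≮H | no k≮end
  with Maybe-map-suc⁻ (traceDown R ((k + O y) ∸ I y)) trace
... | i' , trace' , refl = record
  { passed = y ∷ passed ; vertex = vertex ; rest = rest ; exit = exit ; R-split = cong (y ∷_) R-split
  ; passes = step (≮⇒≥ k≮end) passes ; enters = enters ; enters' = enters' ; input = input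
  ; steps = cong suc steps ; deleted = trans (deleteDown-right y R k k≮H k≮end) (cong (y ∷_) deleted) }
  where
  right : H y + O y ≤ (k + O y) ∸ I y
  right = right-of-inputs⇒right-of-outputs {H y} {I y} {O y} {k} (≮⇒≥ k≮end)
  open DownPath (rigid-downPath R ((k + O y) ∸ I y) i' j trace'
                   (stuck⇒StartsBy y R _ right (proj₁ rigid)) (proj₂ rigid))

-- The place of a leaf above the wire g: xs = P ++ F where the wire passes right
-- of every vertex of F, entering F as k, and the last vertex of P blocks it.
record Ascent (xs : List Vtx) (g : ℕ) : Set where
  field
    P F : List Vtx
    k : ℕ
    xs-split : xs ≡ P ++ F
    passes   : PassesRight k F g
    blocked  : LastStuck P k

-- Lifting a wire above a vertex x it passes on the right.
lift-width : ∀ x k → H x + O x ≤ k → (((k ∸ O x) + I x + O x) ∸ I x) ≡ k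
lift-width x k right = begin
  (k ∸ O x) + I x + O x ∸ I x   ≡⟨ cong (_∸ I x) (+-assoc (k ∸ O x) (I x) (O x)) ⟩
  (k ∸ O x) + (I x + O x) ∸ I x ≡⟨ cong (λ z → (k ∸ O x) + z ∸ I x) (+-comm (I x) (O x)) ⟩
  (k ∸ O x) + (O x + I x) ∸ I x ≡⟨ cong (_∸ I x) (sym (+-assoc (k ∸ O x) (O x) (I x))) ⟩
  (k ∸ O x) + O x + I x ∸ I x   ≡⟨ m+n∸n≡m _ (I x) ⟩
  (k ∸ O x) + O x               ≡⟨ m∸n+n≡m (m+n≤o⇒n≤o (H x) right) ⟩
  k                             ∎
  where open ≡-Reasoning

ascend : ∀ xs g → Ascent xs g
ascend []       g = record { P = [] ; F = [] ; k = g ; xs-split = refl ; passes = done ; blocked = tt }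
ascend (x ∷ xs) g with ascend xs g
... | record { P = y ∷ P ; F = F ; k = k ; xs-split = split ; passes = passes ; blocked = blocked } =
  record { P = x ∷ y ∷ P ; F = F ; k = k ; xs-split = cong (x ∷_) split ; passes = passes ; blocked = blocked }
... | record { P = [] ; F = F ; k = k ; xs-split = split ; passes = passes } with H x + O x ≤? k
...   | yes right = record
  { P = [] ; F = x ∷ F ; k = (k ∸ O x) + I x ; xs-split = cong (x ∷_) split
  ; passes = step (+-monoˡ-≤ (I x) (m+n≤o⇒m≤o∸n (H x) right))
                  (subst (λ w → PassesRight w F g) (sym (lift-width x k right)) passes)
  ; blocked = tt }
...   | no blocked = record
  { P = x ∷ [] ; F = F ; k = k ; xs-split = cong (x ∷_) split ; passes = passes ; blocked = blocked }

-- The ascent is unique: the blocking vertex cannot be passed on the right.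
ascent-unique : ∀ P P' {F F' k k' g} → P ++ F ≡ P' ++ F' → PassesRight k F g → PassesRight k' F' g →
  LastStuck P k → LastStuck P' k' → P ≡ P' × F ≡ F' × k ≡ k'
ascent-unique []          []          refl r r' _ _ = refl , refl , PassesRight-source r r'
ascent-unique []          (x' ∷ [])   {k = k} refl (step right r) r' _ blocked' =
  ⊥-elim (blocked' (subst (H x' + O x' ≤_) (PassesRight-source r r') (right-of-inputs⇒right-of-outputs {H x'} {I x'} {O x'} {k} right)))
ascent-unique []          (x' ∷ y ∷ Q') refl (step _ r) r' _ blocked' with ascent-unique [] (y ∷ Q') refl r r' tt blocked'
... | () , _
ascent-unique (x ∷ [])    []          {k' = k'} refl r (step right r') blocked _ =
  ⊥-elim (blocked (subst (H x + O x ≤_) (PassesRight-source r' r) (right-of-inputs⇒right-of-outputs {H x} {I x} {O x} {k'} right)))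
ascent-unique (x ∷ y ∷ Q) []          refl r (step _ r') blocked _ with ascent-unique (y ∷ Q) [] refl r r' blocked tt
... | () , _
ascent-unique (x ∷ Q)     (x' ∷ Q')   eq r r' blocked blocked'
  with ascent-unique Q Q' (cong (drop 1) eq) r r' (LastStuck-tail x Q blocked) (LastStuck-tail x' Q' blocked')
... | eqP , eqF , eqk = cong₂ _∷_ (cong (head-or x) eq) eqP , eqF , eqk

addInput : Vtx → Vtx
addInput x = vtx (H x) (suc (I x)) (O x)

addInput-removeInput : ∀ {g} y → H y ≤ g → g < H y + I y → y ≡ addInput (vtx (H y) (I y ∸ 1) (O y))
addInput-removeInput (vtx h zero o)    h≤g g<end = ⊥-elim (<⇒≱ (subst (_ <_) (+-identityʳ h) g<end) h≤g)
addInput-removeInput (vtx h (suc i) o) _   _     = refl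

ValidFrom-addInput : ∀ {k F g} x C w → PassesRight k F g → ValidFrom w (F ++ x ∷ C) → g ≤ H x + I x →
  k ≤ w × ValidFrom (suc w) (F ++ addInput x ∷ C)
ValidFrom-addInput x C w done (fits , rest) g≤end =
  ≤-trans g≤end fits , ≤-trans (≤-reflexive (+-suc (H x) (I x))) (s≤s fits) , rest
ValidFrom-addInput {k} {y ∷ F} x C w (step right r) (fits , rest) g≤end
  with ValidFrom-addInput x C _ r rest g≤end
... | k'≤w' , valid' =
  width-reflects-≤ (O y) (m+n≤o⇒n≤o (H y) right) (m+n≤o⇒n≤o (H y) fits) k'≤w' ,
  ≤-trans fits (n≤1+n w) ,
  subst (λ w' → ValidFrom w' (F ++ addInput x ∷ C)) (sym (width-suc (O y) (m+n≤o⇒n≤o (H y) fits))) valid'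

leaf-stuck : ∀ {k F g} x C → PassesRight k F g → H x ≤ g → StuckOn (vtx k 0 1) (F ++ x ∷ C)
leaf-stuck {k} x C done H≤g exch = <⇒≱ (subst (_≤ H x) (+-comm k 1) exch) H≤g
leaf-stuck {k} {y ∷ F} x C (step right r) H≤g exch =
  <⇒≱ (subst (_≤ H y) (+-comm k 1) exch) (m+n≤o⇒m≤o (H y) right)

-- Wires travelling upwards (output side).

shiftLeft shiftRight addOutput : Vtx → Vtx
shiftLeft  x = vtx (H x ∸ 1) (I x) (O x)
shiftRight x = vtx (suc (H x)) (I x) (O x)
addOutput  x = vtx (H x) (I x) (suc (O x))

addOutput-removeOutput : ∀ {g} y → H y ≤ g → g < H y + O y → y ≡ addOutput (vtx (H y) (I y) (O y ∸ 1))
addOutput-removeOutput (vtx h i zero)    h≤g g<end = ⊥-elim (<⇒≱ (subst (_ <_) (+-identityʳ h) g<end) h≤g)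
addOutput-removeOutput (vtx h i (suc o)) _   _     = refl

RightOf : ℕ → List Vtx → Set
RightOf k = All (λ x → k < H x)

shiftRight-shiftLeft : ∀ {k x} → k < H x → x ≡ shiftRight (shiftLeft x)
shiftRight-shiftLeft {x = vtx (suc h) i o} _ = refl

traceUp-left : ∀ y G k → k < H y → traceUp (y ∷ G) k ≡ Maybe.map (map₁ suc) (traceUp G k)
traceUp-left y G k k<H with k <? H y
... | yes _   = refl
... | no k≮H = ⊥-elim (k≮H k<H)

traceUp-enter : ∀ y G k → ¬ k < H y → k < H y + O y → traceUp (y ∷ G) k ≡ just (0 , k ∸ H y)
traceUp-enter y G k k≮H k<end with k <? H y
... | yes k<H = ⊥-elim (k≮H k<H)
... | no _ with k <? H y + O y
...   | yes _    = refl
...   | no k≮end = ⊥-elim (k≮end k<end)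

deleteUp-left : ∀ y G k → k < H y →
  deleteUp (y ∷ G) k ≡ (shiftLeft y ∷ proj₁ (deleteUp G k) , proj₂ (deleteUp G k))
deleteUp-left y G k k<H with k <? H y
... | yes _   = refl
... | no k≮H = ⊥-elim (k≮H k<H)

deleteUp-enter : ∀ y G k → ¬ k < H y → k < H y + O y → deleteUp (y ∷ G) k ≡ (vtx (H y) (I y) (O y ∸ 1) ∷ G , false)
deleteUp-enter y G k k≮H k<end with k <? H y
... | yes k<H = ⊥-elim (k≮H k<H)
... | no _ with k <? H y + O y
...   | yes _    = refl
...   | no k≮end = ⊥-elim (k≮end k<end)

deleteUp-right : ∀ y G k → ¬ k < H y → ¬ k < H y + O y →
  deleteUp (y ∷ G) k ≡ (y ∷ proj₁ (deleteUp G ((k + I y) ∸ O y)) , proj₂ (deleteUp G ((k + I y) ∸ O y)))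
deleteUp-right y G k k≮H k≮end with k <? H y
... | yes k<H = ⊥-elim (k≮H k<H)
... | no _ with k <? H y + O y
...   | yes k<end = ⊥-elim (k≮end k<end)
...   | no _      = refl

trace-past-RightOf : ∀ k G Z → RightOf k G →
  traceUp (G ++ Z) k ≡ Maybe.map (map₁ (length G +_)) (traceUp Z k) ×
  deleteUp (G ++ Z) k ≡ (map shiftLeft G ++ proj₁ (deleteUp Z k) , proj₂ (deleteUp Z k))
trace-past-RightOf k [] Z [] with traceUp Z k
... | just _  = refl , refl
... | nothing = refl , refl
trace-past-RightOf k (y ∷ G) Z (k<H ∷ rightOf) with trace-past-RightOf k G Z rightOf
... | trace , delete =
  trans (traceUp-left y (G ++ Z) k k<H) (trans (cong (Maybe.map (map₁ suc)) trace) (map-suc (traceUp Z k))) ,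
  trans (deleteUp-left y (G ++ Z) k k<H) (cong (λ q → (shiftLeft y ∷ proj₁ q , proj₂ q)) delete)
  where
  map-suc : ∀ (r : Maybe (ℕ × ℕ)) →
    Maybe.map (map₁ suc) (Maybe.map (map₁ (length G +_)) r) ≡ Maybe.map (map₁ (suc (length G) +_)) r
  map-suc (just _) = refl
  map-suc nothing  = refl

record UpPath (k i j : ℕ) (G : List Vtx) : Set where
  field
    passed : List Vtx
    vertex : Vtx
    rest   : List Vtx
    G-split : G ≡ passed ++ vertex ∷ rest
    rightOf : RightOf k passed
    leaves  : H vertex ≤ k
    leaves' : k < H vertex + O vertex
    output  : j ≡ k ∸ H vertex
    steps   : i ≡ length passed
    deleted : deleteUp G k ≡ (map shiftLeft passed ++ vtx (H vertex) (I vertex) (O vertex ∸ 1) ∷ rest , false)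

stuck⇒FirstStuck : ∀ y G k T → k < H y → Rigid (reverse (proj₁ (deleteUp G k)) ++ shiftLeft y ∷ T) → FirstStuck k G
stuck⇒FirstStuck y []      k T k<H rigid = tt
stuck⇒FirstStuck y (z ∷ G) k T k<H rigid right = stuck (≤-trans right (<⇒≤∸1 k<H))
  where
  G↑ : List Vtx
  G↑ = proj₁ (deleteUp G ((k + I z) ∸ O z))
  rigid' : Rigid (reverse (z ∷ G↑) ++ shiftLeft y ∷ T)
  rigid' = subst (λ q → Rigid (reverse (proj₁ q) ++ shiftLeft y ∷ T))
             (deleteUp-right z G k (λ k<H' → <⇒≱ k<H' (m+n≤o⇒m≤o (H z) right)) (λ k<end → <⇒≱ k<end right)) rigid
  stuck : StuckOn z (shiftLeft y ∷ T)
  stuck = proj₁ (Rigid-suffix (reverse G↑) (subst Rigid (reverse-∷-++ z G↑ (shiftLeft y ∷ T)) rigid'))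

rigid-upPath : ∀ G k i j T → traceUp G k ≡ just (i , j) → FirstStuck k G →
  Rigid (reverse (proj₁ (deleteUp G k)) ++ T) → UpPath k i j G
rigid-upPath []      k i j T () _ _
rigid-upPath (y ∷ G) k i j T trace firstStuck rigid with H y ≤? k
... | no H≰k with Maybe-map-suc⁻ (traceUp G k) (trans (sym (traceUp-left y G k (≰⇒> H≰k))) trace)
...   | i' , trace' , refl = record
  { passed = y ∷ passed ; vertex = vertex ; rest = rest ; G-split = cong (y ∷_) G-split ; rightOf = ≰⇒> H≰k ∷ rightOf
  ; leaves = leaves ; leaves' = leaves' ; output = output ; steps = cong suc steps
  ; deleted = trans (deleteUp-left y G k (≰⇒> H≰k)) (cong (λ q → (shiftLeft y ∷ proj₁ q , proj₂ q)) deleted) }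
  where
  rigid' : Rigid (reverse (proj₁ (deleteUp G k)) ++ shiftLeft y ∷ T)
  rigid' = subst Rigid (reverse-∷-++ (shiftLeft y) (proj₁ (deleteUp G k)) T)
             (subst (λ q → Rigid (reverse (proj₁ q) ++ T)) (deleteUp-left y G k (≰⇒> H≰k)) rigid)
  open UpPath (rigid-upPath G k i' j (shiftLeft y ∷ T) trace' (stuck⇒FirstStuck y G k T (≰⇒> H≰k) rigid') rigid')
rigid-upPath (y ∷ G) k i j T trace firstStuck rigid | yes H≤k with H y + O y ≤? k
... | yes right = ⊥-elim (firstStuck right)
... | no end≰k with trans (sym (traceUp-enter y G k (≤⇒≯ H≤k) (≰⇒> end≰k))) trace
...   | refl = record
  { passed = [] ; vertex = y ; rest = G ; G-split = refl ; rightOf = [] ; leaves = H≤k ; leaves' = ≰⇒> end≰k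
  ; output = refl ; steps = refl ; deleted = deleteUp-enter y G k (≤⇒≯ H≤k) (≰⇒> end≰k) }

-- The place of a leaf below the wire k: C = map shiftLeft F ++ R where the
-- vertices of F lie right of k and the leaf cannot be exchanged with R.
record Descent (k : ℕ) (C : List Vtx) : Set where
  field
    F R : List Vtx
    C-split : C ≡ map shiftLeft F ++ R
    rightOf : RightOf k F
    stopped : StuckOn (vtx k 1 0) R

descend : ∀ k C → Descent k C
descend k []      = record { F = [] ; R = [] ; C-split = refl ; rightOf = [] ; stopped = tt }
descend k (y ∷ C) with k ≤? H y
... | yes k≤H = record
  { F = shiftRight y ∷ F ; R = R ; C-split = cong (y ∷_) C-split ; rightOf = s≤s k≤H ∷ rightOf ; stopped = stopped }
  where open Descent (descend k C)
... | no k≰H = record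
  { F = [] ; R = y ∷ C ; C-split = refl ; rightOf = []
  ; stopped = λ exch → k≰H (≤-trans (≤-reflexive (sym (+-identityʳ k))) exch) }

descent-unique : ∀ {k} F F' {R R'} → map shiftLeft F ++ R ≡ map shiftLeft F' ++ R' → RightOf k F → RightOf k F' →
  StuckOn (vtx k 1 0) R → StuckOn (vtx k 1 0) R' → F ≡ F' × R ≡ R'
descent-unique []      []        refl _ _ _ _ = refl , refl
descent-unique {k} []      (x' ∷ F') refl _ (k<H ∷ _) stopped _ =
  ⊥-elim (stopped (≤-trans (≤-reflexive (+-identityʳ k)) (<⇒≤∸1 k<H)))
descent-unique {k} (x ∷ F) []        refl (k<H ∷ _) _ _ stopped' =
  ⊥-elim (stopped' (≤-trans (≤-reflexive (+-identityʳ k)) (<⇒≤∸1 k<H)))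
descent-unique (x ∷ F) (x' ∷ F') eq (k<H ∷ rightOf) (k<H' ∷ rightOf') stopped stopped'
  with descent-unique F F' (cong (drop 1) eq) rightOf rightOf' stopped stopped'
... | eqF , eqR = cong₂ _∷_ eqx eqF , eqR
  where
  eqx : x ≡ x'
  eqx = trans (shiftRight-shiftLeft k<H)
          (trans (cong shiftRight (cong (head-or (shiftLeft x)) eq)) (sym (shiftRight-shiftLeft k<H')))

ValidFrom-insertLeaf : ∀ k F R w → RightOf k F → k ≤ w → ValidFrom w (map shiftLeft F ++ R) →
  ValidFrom (suc w) (F ++ vtx k 1 0 ∷ R)
ValidFrom-insertLeaf k []      R w []  k≤w valid =
  ≤-trans (≤-reflexive (+-comm k 1)) (s≤s k≤w) , subst (λ w' → ValidFrom w' R) (sym (+-identityʳ w)) valid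
ValidFrom-insertLeaf k (x ∷ F) R w (k<H ∷ rightOf) k≤w (fits , rest) =
  ≤-trans (≤-reflexive (cong (λ z → H z + I x) (shiftRight-shiftLeft {x = x} k<H))) (s≤s fits) ,
  subst (λ w' → ValidFrom w' (F ++ vtx k 1 0 ∷ R)) (sym (width-suc (O x) (m+n≤o⇒n≤o (H x ∸ 1) fits)))
    (ValidFrom-insertLeaf k F R _ rightOf k≤w' rest)
  where
  k≤w' : k ≤ (w + O x) ∸ I x
  k≤w' = ≤-trans (<⇒≤∸1 k<H) (≤-trans (m+n≤o⇒m≤o∸n (H x ∸ 1) fits) (∸-monoˡ-≤ (I x) (m≤m+n w (O x))))

ValidFrom-addOutput : ∀ k v F R w → RightOf k F → k ≤ H v + O v → ValidFrom w (v ∷ map shiftLeft F ++ R) →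
  ValidFrom w (addOutput v ∷ F ++ vtx k 1 0 ∷ R)
ValidFrom-addOutput k v F R w rightOf k≤end (fits , rest) =
  fits ,
  subst (λ w' → ValidFrom w' (F ++ vtx k 1 0 ∷ R))
    (trans (sym (width-suc (O v) (m+n≤o⇒n≤o (H v) fits))) (cong (_∸ I v) (sym (+-suc w (O v)))))
    (ValidFrom-insertLeaf k F R _ rightOf
      (≤-trans k≤end (right-of-inputs⇒right-of-outputs {H v} {I v} {O v} {w} fits)) rest)

Rigid-insertLeaf : ∀ k F R → RightOf k F → StuckOn (vtx k 1 0) R → Rigid (map shiftLeft F ++ R) →
  Rigid (F ++ vtx k 1 0 ∷ R)
Rigid-insertLeaf k []          R []  stopped rigid = stopped , rigid
Rigid-insertLeaf k (x ∷ [])    R (k<H ∷ []) stopped (_ , rigid) =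
  (λ exch → <⇒≱ k<H (m+n≤o⇒m≤o (H x) exch)) , Rigid-insertLeaf k [] R [] stopped rigid
Rigid-insertLeaf k (x ∷ y ∷ F) R (k<H ∷ k<H' ∷ rightOf) stopped (stuck , rigid) =
  (λ exch → stuck (shift-exch (≤-trans (s≤s z≤n) k<H) (≤-trans (s≤s z≤n) k<H') exch)) ,
  Rigid-insertLeaf k (y ∷ F) R (k<H' ∷ rightOf) stopped rigid
  where
  shift-exch : ∀ {a b o} → 0 < a → 0 < b → a + o ≤ b → a ∸ 1 + o ≤ b ∸ 1
  shift-exch {suc a} {suc b} _ _ (s≤s le) = le

Rigid-addOutput : ∀ k v F R → RightOf k F → k ≤ H v + O v → StuckOn (vtx k 1 0) R →
  Rigid (v ∷ map shiftLeft F ++ R) → Rigid (addOutput v ∷ F ++ vtx k 1 0 ∷ R)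
Rigid-addOutput k v []      R rightOf k≤end stopped (_ , rigid) =
  (λ exch → <⇒≱ (≤-trans (≤-reflexive (sym (+-suc (H v) (O v)))) exch) k≤end) ,
  Rigid-insertLeaf k [] R rightOf stopped rigid
Rigid-addOutput k v (x ∷ F) R (k<H ∷ rightOf) k≤end stopped (stuck , rigid) =
  (λ exch → stuck (≤-pred (≤-trans (≤-reflexive (sym (+-suc (H v) (O v))))
                            (≤-trans exch (≤-reflexive (cong H (shiftRight-shiftLeft {x = x} k<H))))))) ,
  Rigid-insertLeaf k (x ∷ F) R (k<H ∷ rightOf) stopped rigid

position : ∀ P (y : Vtx) R → Fin (length (P ++ y ∷ R))
position []      y R = fzero
position (x ∷ P) y R = fsuc (position P y R)

position-toℕ : ∀ P y R → toℕ (position P y R) ≡ length P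
position-toℕ []      y R = refl
position-toℕ (x ∷ P) y R = cong suc (position-toℕ P y R)

position-lookup : ∀ P y R → lookup (P ++ y ∷ R) (position P y R) ≡ y
position-lookup []      y R = refl
position-lookup (x ∷ P) y R = position-lookup P y R

position-take : ∀ P y R → take (toℕ (position P y R)) (P ++ y ∷ R) ≡ P
position-take []      y R = refl
position-take (x ∷ P) y R = cong (x ∷_) (position-take P y R)

position-drop : ∀ P y R → drop (suc (toℕ (position P y R))) (P ++ y ∷ R) ≡ R
position-drop []      y R = refl
position-drop (x ∷ P) y R = position-drop P y R

<ᵇ-+ : ∀ a b → (a + b <ᵇ a) ≡ false
<ᵇ-+ zero    b = refl
<ᵇ-+ (suc a) b = <ᵇ-+ a b

<ᵇ-+-suc : ∀ a c → (a <ᵇ a + suc c) ≡ true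
<ᵇ-+-suc zero    c = refl
<ᵇ-+-suc (suc a) c = <ᵇ-+-suc a c

punchIn-below : ∀ a b → punchInℕ a (a + b) ≡ suc (a + b)
punchIn-below a b rewrite <ᵇ-+ a b = refl

punchIn-above : ∀ a c → punchInℕ (a + suc c) a ≡ a
punchIn-above a c rewrite <ᵇ-+-suc a c = refl

punchIn-below⁻ : ∀ a b c → punchInℕ a b ≡ suc (a + c) → b ≡ a + c
punchIn-below⁻ a b c eq with b <ᵇ a in lt
... | true  = ⊥-elim (<⇒≱ (<ᵇ⇒< b a (subst T (sym lt) tt))
                          (≤-trans (m≤m+n a c) (≤-trans (n≤1+n _) (≤-reflexive (sym eq)))))
... | false = suc-injective eq

punchIn-above⁻ : ∀ a b i → a ≡ suc (i + punchInℕ a b) → punchInℕ a b ≡ b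
punchIn-above⁻ a b i eq with b <ᵇ a in lt
... | true  = refl
... | false = ⊥-elim (<⇒≱ (s≤s (≤-trans (n≤1+n b) (m≤n+m (suc b) i)))
                          (≤-trans (≤-reflexive (sym eq)) (≮⇒≥ (λ b<a → subst T lt (<⇒<ᵇ b<a)))))

module InputLeaf (S₀ : ℕ) (L : List Vtx) (v : Fin (length L)) (j : ℕ) where
  above below : List Vtx
  above = take (toℕ v) L
  below = drop (suc (toℕ v)) L

  target : Vtx
  target = lookup L v

  wire : ℕ
  wire = H target + j

  ascent : Ascent above wire
  ascent = ascend above wire

  P F R : List Vtx
  P = Ascent.P ascent
  F = Ascent.F ascent
  R = F ++ addInput target ∷ below

  leaf : Vtx
  leaf = vtx (Ascent.k ascent) 0 1

  L' : List Vtx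
  L' = P ++ leaf ∷ R

  D' : Diagram
  D' = diagram S₀ L'

  m : Fin (length L')
  m = position P leaf R

  L-split : L ≡ P ++ F ++ target ∷ below
  L-split = trans (split-at L v) (trans (cong (_++ target ∷ below) (Ascent.xs-split ascent)) (++-assoc P F (target ∷ below)))

  module _ (j≤I : j ≤ I target) where
    leafWire : traceDown R (Ascent.k ascent) ≡ just (length F , wire ∸ H target) ×
               deleteDown R (Ascent.k ascent) ≡ F ++ target ∷ below
    leafWire = traceDown-PassesRight (addInput target) below (Ascent.passes ascent) (m≤m+n (H target) j)
                 (≤-trans (≤-reflexive (sym (+-suc (H target) j))) (+-monoʳ-≤ (H target) (s≤s j≤I)))

    v-index : punchInℕ (toℕ m) (toℕ v) ≡ suc (toℕ m + length F)
    v-index = begin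
      punchInℕ (toℕ m) (toℕ v)                  ≡⟨ cong₂ punchInℕ (position-toℕ P leaf R) v≡ ⟩
      punchInℕ (length P) (length P + length F) ≡⟨ punchIn-below (length P) (length F) ⟩
      suc (length P + length F)                 ≡⟨ cong (λ z → suc (z + length F)) (sym (position-toℕ P leaf R)) ⟩
      suc (toℕ m + length F)                    ∎
      where
      open ≡-Reasoning
      v≡ : toℕ v ≡ length P + length F
      v≡ = trans (sym (length-take L v)) (trans (cong length (Ascent.xs-split ascent)) (length-++ P))

    incidence : LeafIncidence inputs D' m (punchInℕ (toℕ m) (toℕ v)) j
    incidence =
      subst (λ z → I z ≡ 0) (sym (position-lookup P leaf R)) refl ,
      subst (λ z → O z ≡ 1) (sym (position-lookup P leaf R)) refl ,
      length F ,
      subst₂ (λ (below-m : List Vtx) (leaf-m : Vtx) → traceDown below-m (H leaf-m) ≡ just (length F , j))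
             (sym (position-drop P leaf R)) (sym (position-lookup P leaf R))
             (trans (proj₁ leafWire) (cong (λ z → just (length F , z)) (m+n∸m≡n (H target) j))) ,
      v-index

    deletes : deleteLeaf inputs D' m ≡ diagram S₀ L
    deletes = cong (diagram S₀) (begin
      take (toℕ m) L' ++ deleteDown (drop (suc (toℕ m)) L') (H (lookup L' m))
        ≡⟨ cong₂ (λ above-m below-m → above-m ++ deleteDown below-m (H (lookup L' m)))
                 (position-take P leaf R) (position-drop P leaf R) ⟩
      P ++ deleteDown R (H (lookup L' m))   ≡⟨ cong (λ z → P ++ deleteDown R (H z)) (position-lookup P leaf R) ⟩
      P ++ deleteDown R (Ascent.k ascent)   ≡⟨ cong (P ++_) (proj₂ leafWire) ⟩
      P ++ F ++ target ∷ below              ≡⟨ sym L-split ⟩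
      L                                     ∎)
      where open ≡-Reasoning

    module _ (valid : ValidFrom S₀ L) (rigid : Rigid L) where
      valid' : ValidFrom S₀ L'
      valid' = ValidFrom-join S₀ P (ValidFrom-prefix S₀ P validL)
                 (≤-trans (≤-reflexive (+-identityʳ _)) (proj₁ extended) ,
                  subst (λ w → ValidFrom w R) (+-comm 1 (wAfter S₀ P)) (proj₂ extended))
        where
        validL : ValidFrom S₀ (P ++ F ++ target ∷ below)
        validL = subst (ValidFrom S₀) L-split valid
        extended : Ascent.k ascent ≤ wAfter S₀ P × ValidFrom (suc (wAfter S₀ P)) R
        extended = ValidFrom-addInput target below (wAfter S₀ P) (Ascent.passes ascent)
                     (ValidFrom-suffix S₀ P validL) (+-monoʳ-≤ (H target) j≤I)

      rigid' : Rigid L'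
      rigid' = Rigid-join P (Rigid-prefix P rigidL) (Ascent.blocked ascent)
                 (leaf-stuck (addInput target) below (Ascent.passes ascent) (m≤m+n (H target) j) ,
                  Rigid-replace F refl refl (Rigid-suffix P rigidL))
        where
        rigidL : Rigid (P ++ F ++ target ∷ below)
        rigidL = subst Rigid L-split rigid

      existence : LeafExtension (diagram S₀ L) v inputs j D' × RightNormalForm D'
      existence = (ValidFrom⇒Valid S₀ L' valid' , m , incidence , deletes) ,
                  ValidFrom⇒Valid S₀ L' valid' , Rigid⇒NoRightExchange S₀ L' rigid'

  -- Any right-normal leaf extension is D': following the leaf's wire down to v
  -- in it recovers the ascent of the wire of v.
  uniqueness : Rigid L → ∀ S'' L'' → LeafExtension (diagram S₀ L) v inputs j (diagram S'' L'') →
    RightNormalForm (diagram S'' L'') → diagram S'' L'' ≡ D'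
  uniqueness rigid S'' L'' (_ , m'' , (I≡0 , O≡1 , i , trace , index) , deletes'') (_ , noEx'') =
    cong₂ diagram (cong S deletes'') (trans (split-at L'' m'') (cong₂ _++_ P''≡P (cong₂ _∷_ leaf''≡leaf R''≡R)))
    where
    P'' R'' : List Vtx
    P'' = take (toℕ m'') L''
    R'' = drop (suc (toℕ m'')) L''
    leaf'' : Vtx
    leaf'' = lookup L'' m''

    rigid'' : Rigid (P'' ++ leaf'' ∷ R'')
    rigid'' = subst Rigid (split-at L'' m'') (NoRightExchange⇒Rigid S'' L'' noEx'')
    L-eq : P'' ++ deleteDown R'' (H leaf'') ≡ L
    L-eq = cong vs deletes''

    path : DownPath (H leaf'') i j R''
    path = rigid-downPath R'' (H leaf'') i j trace
             (stuck-leaf⇒StartsBy leaf'' R'' O≡1 (proj₁ (Rigid-suffix P'' rigid'')))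
             (Rigid-suffix P'' (subst Rigid (sym L-eq) rigid))
    open DownPath path

    -- deleting the leaf restores v as the vertex the wire enters
    L-shape : (P'' ++ passed) ++ vtx (H vertex) (I vertex ∸ 1) (O vertex) ∷ rest ≡ above ++ target ∷ below
    L-shape = trans (++-assoc P'' passed _) (trans (cong (P'' ++_) (sym deleted)) (trans L-eq (split-at L v)))
    same-length : length (P'' ++ passed) ≡ length above
    same-length = trans (length-++ P'') (trans (cong₂ _+_ (length-take L'' m'') (sym steps))
                    (trans (sym (punchIn-below⁻ (toℕ m'') (toℕ v) i index)) (sym (length-take L v))))
    shape : P'' ++ passed ≡ above × vtx (H vertex) (I vertex ∸ 1) (O vertex) ≡ target × rest ≡ below
    shape = ++-∷-cancel (P'' ++ passed) above L-shape same-length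

    exit≡wire : exit ≡ wire
    exit≡wire = trans (sym (m+[n∸m]≡n enters)) (cong₂ _+_ (cong H (proj₁ (proj₂ shape))) (sym input))
    same-ascent : P'' ≡ P × passed ≡ F × H leaf'' ≡ Ascent.k ascent
    same-ascent = ascent-unique P'' P (trans (proj₁ shape) (Ascent.xs-split ascent))
                    (subst (PassesRight (H leaf'') passed) exit≡wire passes) (Ascent.passes ascent)
                    (Rigid-last P'' rigid'') (Ascent.blocked ascent)

    P''≡P : P'' ≡ P
    P''≡P = proj₁ same-ascent
    leaf''≡leaf : leaf'' ≡ leaf
    leaf''≡leaf = cong-vtx (proj₂ (proj₂ same-ascent)) I≡0 O≡1
    R''≡R : R'' ≡ R
    R''≡R = trans R-split (cong₂ _++_ (proj₁ (proj₂ same-ascent))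
              (cong₂ _∷_ (trans (addInput-removeInput vertex enters enters') (cong addInput (proj₁ (proj₂ shape))))
                         (proj₂ (proj₂ shape))))

module OutputLeaf (S₀ : ℕ) (L : List Vtx) (v : Fin (length L)) (j : ℕ) where
  above below : List Vtx
  above = take (toℕ v) L
  below = drop (suc (toℕ v)) L

  target : Vtx
  target = lookup L v

  wire : ℕ
  wire = H target + j

  descent : Descent wire below
  descent = descend wire below

  F P R : List Vtx
  F = Descent.F descent
  P = above ++ addOutput target ∷ F
  R = Descent.R descent

  leaf : Vtx
  leaf = vtx wire 1 0

  L' : List Vtx
  L' = P ++ leaf ∷ R

  D' : Diagram
  D' = diagram S₀ L'

  m : Fin (length L')
  m = position P leaf R

  L-split : L ≡ above ++ target ∷ map shiftLeft F ++ R
  L-split = trans (split-at L v) (cong (λ z → above ++ target ∷ z) (Descent.C-split descent))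

  module _ (j≤O : j ≤ O target) where
    between : ℕ
    between = length (reverse F) + 0

    wire-enters : ¬ wire < H target
    wire-enters wire<H = <⇒≱ wire<H (m≤m+n (H target) j)
    wire-enters' : wire < H target + O (addOutput target)
    wire-enters' = ≤-trans (≤-reflexive (sym (+-suc (H target) j))) (+-monoʳ-≤ (H target) (s≤s j≤O))

    leafWire : traceUp (reverse P) wire ≡ just (between , j) ×
               deleteUp (reverse P) wire ≡ (map shiftLeft (reverse F) ++ target ∷ reverse above , false)
    leafWire with trace-past-RightOf wire (reverse F) (addOutput target ∷ reverse above) (All-reverse (Descent.rightOf descent))
    ... | trace , delete rewrite reverse-++-∷ above (addOutput target) F =
      trans trace (trans (cong (Maybe.map (map₁ (length (reverse F) +_)))
                               (traceUp-enter (addOutput target) (reverse above) wire wire-enters wire-enters'))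
                         (cong (λ z → just (between , z)) (m+n∸m≡n (H target) j))) ,
      trans delete (cong (λ q → (map shiftLeft (reverse F) ++ proj₁ q , proj₂ q))
                         (deleteUp-enter (addOutput target) (reverse above) wire wire-enters wire-enters'))

    m-index : toℕ m ≡ suc (between + punchInℕ (toℕ m) (toℕ v))
    m-index = begin
      toℕ m                                  ≡⟨ m≡ ⟩
      length above + suc (length F)          ≡⟨ +-suc (length above) (length F) ⟩
      suc (length above + length F)          ≡⟨ cong suc (+-comm (length above) (length F)) ⟩
      suc (length F + length above)          ≡⟨ cong₂ (λ a b → suc (a + b))
                                                   (sym (trans (+-identityʳ _) (length-reverse F)))
                                                   (sym (punchIn-above (length above) (length F))) ⟩
      suc (between + punchInℕ (length above + suc (length F)) (length above))
                                             ≡⟨ cong₂ (λ a b → suc (between + punchInℕ a b)) (sym m≡) (length-take L v) ⟩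
      suc (between + punchInℕ (toℕ m) (toℕ v)) ∎
      where
      open ≡-Reasoning
      m≡ : toℕ m ≡ length above + suc (length F)
      m≡ = trans (position-toℕ P leaf R) (length-++ above)

    incidence : LeafIncidence outputs D' m (punchInℕ (toℕ m) (toℕ v)) j
    incidence =
      subst (λ z → I z ≡ 1) (sym (position-lookup P leaf R)) refl ,
      subst (λ z → O z ≡ 0) (sym (position-lookup P leaf R)) refl ,
      between ,
      subst₂ (λ (above-m : List Vtx) (leaf-m : Vtx) → traceUp (reverse above-m) (H leaf-m) ≡ just (between , j))
             (sym (position-take P leaf R)) (sym (position-lookup P leaf R)) (proj₁ leafWire) ,
      m-index

    deletes : deleteLeaf outputs D' m ≡ diagram S₀ L
    deletes =
      trans (cong₂ (λ (above-m : List Vtx) (leaf-m : Vtx) →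
                      let removed = deleteUp (reverse above-m) (H leaf-m) in
                      diagram (if proj₂ removed then S₀ ∸ 1 else S₀) (reverse (proj₁ removed) ++ drop (suc (toℕ m)) L'))
                   (position-take P leaf R) (position-lookup P leaf R))
            (cong₂ diagram (cong (λ q → if proj₂ q then S₀ ∸ 1 else S₀) (proj₂ leafWire)) (begin
              reverse (proj₁ (deleteUp (reverse P) wire)) ++ drop (suc (toℕ m)) L'
                ≡⟨ cong₂ (λ q z → reverse (proj₁ q) ++ z) (proj₂ leafWire) (position-drop P leaf R) ⟩
              reverse (map shiftLeft (reverse F) ++ target ∷ reverse above) ++ R
                ≡⟨ cong (_++ R) (reverse-++-∷ (map shiftLeft (reverse F)) target (reverse above)) ⟩
              (reverse (reverse above) ++ target ∷ reverse (map shiftLeft (reverse F))) ++ R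
                ≡⟨ cong₂ (λ a b → (a ++ target ∷ b) ++ R) (reverse-involutive above) (reverse-map-reverse shiftLeft F) ⟩
              (above ++ target ∷ map shiftLeft F) ++ R
                ≡⟨ ++-assoc above (target ∷ map shiftLeft F) R ⟩
              above ++ target ∷ map shiftLeft F ++ R
                ≡⟨ sym L-split ⟩
              L ∎))
      where open ≡-Reasoning

    L'-split : L' ≡ above ++ addOutput target ∷ F ++ leaf ∷ R
    L'-split = ++-assoc above (addOutput target ∷ F) (leaf ∷ R)

    module _ (valid : ValidFrom S₀ L) (rigid : Rigid L) where
      wire≤end : wire ≤ H target + O target
      wire≤end = +-monoʳ-≤ (H target) j≤O

      valid' : ValidFrom S₀ L'
      valid' = subst (ValidFrom S₀) (sym L'-split) (ValidFrom-join S₀ above (ValidFrom-prefix S₀ above validL)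
                 (ValidFrom-addOutput wire target F R _ (Descent.rightOf descent) wire≤end (ValidFrom-suffix S₀ above validL)))
        where
        validL : ValidFrom S₀ (above ++ target ∷ map shiftLeft F ++ R)
        validL = subst (ValidFrom S₀) L-split valid

      rigid' : Rigid L'
      rigid' = subst Rigid (sym L'-split) (Rigid-join above (Rigid-prefix above rigidL) (Rigid-last above rigidL)
                 (Rigid-addOutput wire target F R (Descent.rightOf descent) wire≤end (Descent.stopped descent)
                    (Rigid-suffix above rigidL)))
        where
        rigidL : Rigid (above ++ target ∷ map shiftLeft F ++ R)
        rigidL = subst Rigid L-split rigid

      existence : LeafExtension (diagram S₀ L) v outputs j D' × RightNormalForm D'
      existence = (ValidFrom⇒Valid S₀ L' valid' , m , incidence , deletes) ,
                  ValidFrom⇒Valid S₀ L' valid' , Rigid⇒NoRightExchange S₀ L' rigid'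

  -- Any right-normal leaf extension is D': following the leaf's wire up to v
  -- in it recovers the descent of the wire of v.
  uniqueness : Rigid L → ∀ S'' L'' → LeafExtension (diagram S₀ L) v outputs j (diagram S'' L'') →
    RightNormalForm (diagram S'' L'') → diagram S'' L'' ≡ D'
  uniqueness rigid S'' L'' (_ , m'' , (I≡1 , O≡0 , i , trace , index) , deletes'') (_ , noEx'') =
    cong₂ diagram S''≡S₀ (trans (split-at L'' m'') (cong₂ _++_ P''≡P (cong₂ _∷_ leaf''≡leaf R''≡R)))
    where
    P'' R'' : List Vtx
    P'' = take (toℕ m'') L''
    R'' = drop (suc (toℕ m'')) L''
    leaf'' : Vtx
    leaf'' = lookup L'' m''

    rigid'' : Rigid (P'' ++ leaf'' ∷ R'')
    rigid'' = subst Rigid (split-at L'' m'') (NoRightExchange⇒Rigid S'' L'' noEx'')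
    L-eq : reverse (proj₁ (deleteUp (reverse P'') (H leaf''))) ++ R'' ≡ L
    L-eq = cong vs deletes''

    path : UpPath (H leaf'') i j (reverse P'')
    path = rigid-upPath (reverse P'') (H leaf'') i j R'' trace
             (LastStuck⇒FirstStuck-reverse P'' (H leaf'') (Rigid-last P'' rigid''))
             (subst Rigid (sym L-eq) rigid)
    open UpPath path

    S''≡S₀ : S'' ≡ S₀
    S''≡S₀ = trans (cong (λ q → if proj₂ q then S'' ∸ 1 else S'') (sym deleted)) (cong S deletes'')

    -- deleting the leaf restores v as the vertex the wire leaves
    L-shape : reverse rest ++ vtx (H vertex) (I vertex) (O vertex ∸ 1) ∷ (reverse (map shiftLeft passed) ++ R'')
              ≡ above ++ target ∷ below
    L-shape = begin
      reverse rest ++ vertex⁻ ∷ (reverse (map shiftLeft passed) ++ R'')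
        ≡⟨ sym (++-assoc (reverse rest) (vertex⁻ ∷ reverse (map shiftLeft passed)) R'') ⟩
      (reverse rest ++ vertex⁻ ∷ reverse (map shiftLeft passed)) ++ R''
        ≡⟨ cong (_++ R'') (sym (reverse-++-∷ (map shiftLeft passed) vertex⁻ rest)) ⟩
      reverse (map shiftLeft passed ++ vertex⁻ ∷ rest) ++ R''
        ≡⟨ cong (λ q → reverse (proj₁ q) ++ R'') (sym deleted) ⟩
      reverse (proj₁ (deleteUp (reverse P'') (H leaf''))) ++ R''
        ≡⟨ trans L-eq (split-at L v) ⟩
      above ++ target ∷ below ∎
      where
      open ≡-Reasoning
      vertex⁻ : Vtx
      vertex⁻ = vtx (H vertex) (I vertex) (O vertex ∸ 1)

    P''-shape : P'' ≡ reverse rest ++ vertex ∷ reverse passed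
    P''-shape = trans (sym (reverse-involutive P'')) (trans (cong reverse G-split) (reverse-++-∷ passed vertex rest))

    rest-length : length rest ≡ toℕ v
    rest-length = +-cancelʳ-≡ (suc (length passed)) (length rest) (toℕ v) (begin
      length rest + suc (length passed)
        ≡⟨ cong₂ _+_ (sym (length-reverse rest)) (cong suc (sym (length-reverse passed))) ⟩
      length (reverse rest) + length (vertex ∷ reverse passed) ≡⟨ sym (length-++ (reverse rest)) ⟩
      length (reverse rest ++ vertex ∷ reverse passed)         ≡⟨ cong length (sym P''-shape) ⟩
      length P''                                               ≡⟨ length-take L'' m'' ⟩
      toℕ m''                                                  ≡⟨ index ⟩
      suc (i + punchInℕ (toℕ m'') (toℕ v))                     ≡⟨ cong₂ (λ a c → suc (a + c)) steps
                                                                    (punchIn-above⁻ (toℕ m'') (toℕ v) i index) ⟩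
      suc (length passed + toℕ v)                              ≡⟨ cong suc (+-comm (length passed) (toℕ v)) ⟩
      suc (toℕ v + length passed)                              ≡⟨ sym (+-suc (toℕ v) (length passed)) ⟩
      toℕ v + suc (length passed)                              ∎)
      where open ≡-Reasoning

    shape : reverse rest ≡ above × vtx (H vertex) (I vertex) (O vertex ∸ 1) ≡ target ×
            reverse (map shiftLeft passed) ++ R'' ≡ below
    shape = ++-∷-cancel (reverse rest) above L-shape
              (trans (length-reverse rest) (trans rest-length (sym (length-take L v))))

    leaf-wire : H leaf'' ≡ wire
    leaf-wire = trans (sym (m+[n∸m]≡n leaves)) (cong₂ _+_ (cong H (proj₁ (proj₂ shape))) (sym output))
    leaf''≡leaf : leaf'' ≡ leaf
    leaf''≡leaf = cong-vtx leaf-wire I≡1 O≡0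

    same-descent : reverse passed ≡ F × R'' ≡ R
    same-descent = descent-unique (reverse passed) F
      (trans (cong (_++ R'') (reverse-map shiftLeft passed)) (trans (proj₂ (proj₂ shape)) (Descent.C-split descent)))
      (subst (λ z → RightOf z (reverse passed)) leaf-wire (All-reverse rightOf)) (Descent.rightOf descent)
      (subst (λ z → StuckOn z R'') leaf''≡leaf (proj₁ (Rigid-suffix P'' rigid''))) (Descent.stopped descent)

    P''≡P : P'' ≡ P
    P''≡P = trans P''-shape (cong₂ _++_ (proj₁ shape)
              (cong₂ _∷_ (trans (addOutput-removeOutput vertex leaves leaves') (cong addOutput (proj₁ (proj₂ shape))))
                         (proj₁ same-descent)))
    R''≡R : R'' ≡ R
    R''≡R = proj₂ same-descent

lemma40 : (D : Diagram) → Valid D → Connected D → RightNormalForm D →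
          (v : Fin (N D)) (s : Side) (j : ℕ) → j ≤ arity s (V D v) →
          Σ Diagram λ D' → (LeafExtension D v s j D' × RightNormalForm D') ×
            ((D'' : Diagram) → LeafExtension D v s j D'' → RightNormalForm D'' → D'' ≡ D')
lemma40 (diagram S₀ L) valid _ (_ , noEx) v inputs j j≤I =
  InputLeaf.D' S₀ L v j ,
  InputLeaf.existence S₀ L v j j≤I (Valid⇒ValidFrom S₀ L valid) rigid ,
  λ { (diagram S'' L'') → InputLeaf.uniqueness S₀ L v j rigid S'' L'' }
  where
  rigid : Rigid L
  rigid = NoRightExchange⇒Rigid S₀ L noEx
lemma40 (diagram S₀ L) valid _ (_ , noEx) v outputs j j≤O =
  OutputLeaf.D' S₀ L v j ,
  OutputLeaf.existence S₀ L v j j≤O (Valid⇒ValidFrom S₀ L valid) rigid ,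
  λ { (diagram S'' L'') → OutputLeaf.uniqueness S₀ L v j rigid S'' L'' }
  where
  rigid : Rigid L
  rigid = NoRightExchange⇒Rigid S₀ L noEx
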